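{- For all positive integers $n,p$ and $q\ge 2$, the Hamming graph $H(n,pq)$ covers the multigraph $pH(n,q)+n(p-1)I$.
   Context: The Hamming graph $H(n,q)$ has vertex set $\mathbb{Z}_q^n$; two vertices are adjacent iff they differ in exactly one coordinate. For a multigraph $G$, $tG$ denotes the multigraph in which every edge and loop of $G$ has multiplicity multiplied by $t$, and $G+sI$ is obtained by adding $s$ loops at every vertex (a loop at $v$ contributes $v$ once to the neighbor multiset of $v$); if $s=0$ nothing is added. A multigraph $G=(V,E)$ covers a multigraph $H=(U,W)$ if there is a surjective map $\varphi:V\to U$ such that for every $v\in V$ the multiset of $\varphi(u)$ over the neighbors $u$ of $v$ (with multiplicity) equals the multiset of neighbors of $\varphi(v)$ in $H$ (with multiplicity). -}

module Defs where

open import Data.Nat using (ℕ; zero; suc; _+_; _*_; _≡ᵇ_)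
open import Data.Fin using (Fin)
import Data.Fin as Fin
open import Data.Vec using (Vec; []; _∷_)
open import Data.Vec.Properties using (≡-dec)
open import Data.List using (map; allFin)
open import Data.Nat.ListAction using (sum)
open import Data.Bool using (if_then_else_)
open import Data.Product using (∃; _×_)
open import Relation.Nullary using (does)
open import Relation.Binary.PropositionalEquality using (_≡_)

-- Vertex set ℤ_k^n, represented as length-n vectors over Fin k.
Vtx : ℕ → ℕ → Set
Vtx n k = Vec (Fin k) n

_==_ : ∀ {n k} → Vtx n k → Vtx n k → Data.Bool.Bool
u == v = does (≡-dec Fin._≟_ u v)

-- A multigraph on vertex set ℤ_k^n, given by its (symmetric) multiplicity
-- function: M u v = number of edges between u and v (for u = v: number of
-- loops at u; each loop contributes u once to the neighbour multiset of u).
-- Hence the neighbour multiset of v is the function u ↦ M v u.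
MGraph : ℕ → ℕ → Set
MGraph n k = Vtx n k → Vtx n k → ℕ

∑V : ∀ {k} n → (Vtx n k → ℕ) → ℕ
∑V {k} zero    f = f []
∑V {k} (suc n) f = sum (map (λ i → ∑V n (λ xs → f (i ∷ xs))) (allFin k))

dist : ∀ {n k} → Vtx n k → Vtx n k → ℕ
dist []       []       = 0
dist (x ∷ xs) (y ∷ ys) = (if does (x Fin.≟ y) then 0 else 1) + dist xs ys

Hamming : (n q : ℕ) → MGraph n q
Hamming n q u v = if dist u v ≡ᵇ 1 then 1 else 0

scale : ∀ {n k} → ℕ → MGraph n k → MGraph n k
scale t G u v = t * G u v

-- G + s I : add s loops at every vertex.
addLoops : ∀ {n k} → MGraph n k → ℕ → MGraph n k
addLoops G s u v = G u v + (if u == v then s else 0)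

Surj : ∀ {A B : Set} → (A → B) → Set
Surj {A} {B} φ = ∀ (b : B) → ∃ λ (a : A) → φ a ≡ b

-- G covers H: a surjection φ such that for every v, the multiset
-- {φ(u) : u neighbour of v in G} equals the neighbour multiset of φ(v) in H,
-- i.e. for every vertex w of H, the multiplicity of w in the image multiset
-- (sum over u with φ u = w of G v u) equals H (φ v) w.
Covers : ∀ {n k m l} → MGraph n k → MGraph m l → Set
Covers {n} {k} {m} {l} G H =
  ∃ λ (φ : Vtx n k → Vtx m l) → Surj φ × (∀ v w →
    ∑V n (λ u → if φ u == w then G v u else 0) ≡ H (φ v) w)

module Submission where

-- Call f : Fin k → Fin l equitable with fibre size p if every
-- y ∈ Fin l has exactly p preimages. Applying f coordinatewise gives
-- φ : ℤ_k^n → ℤ_l^n. For v ∈ ℤ_k^n, w ∈ ℤ_l^n let N_d(v,w) count the u with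
-- φ u = w at Hamming distance d from v. Splitting ℤ_k^(n+1) = ℤ_k × ℤ_k^n,
-- distance 0 means distance 0 in both factors, and distance 1 means
-- (same first coordinate, distance 1) or (other first coordinate,
-- distance 0). Summing over the first coordinate, induction on n gives
--   N_0(v,w) = [φ v = w],   N_1(v,w) = p·[d(φ v,w) = 1] + [φ v = w]·n(p-1),
-- which is precisely the covering condition H(n,k) → pH(n,l) + n(p-1)I;
-- a section of f makes φ surjective. The theorem is the instance
-- k = pq, l = q, f = reduction modulo q.

open import Defs
open import Data.Nat using (ℕ; _*_; _∸_; _≤_)
open import Data.Nat using (zero; suc; _+_; _≡ᵇ_)
open import Data.Nat.Properties
  using (+-*-semiring; +-assoc; +-identityʳ; *-identityʳ; *-zeroʳ; *-distribˡ-+)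
open import Data.Nat.Tactic.RingSolver using (solve-∀)
open import Data.Nat.ListAction using (sum)
open import Data.Bool using (Bool; true; false; if_then_else_; _∧_; not)
open import Data.Fin using (Fin; _↑ˡ_; _↑ʳ_; combine; remainder)
import Data.Fin as Fin
open import Data.Fin.Properties using (remQuot-combine)
open import Data.Vec using ([]; _∷_)
import Data.Vec as Vec
import Data.Vec.Properties as Vec
open import Data.List using (allFin; tabulate)
open import Data.List.Properties using (map-tabulate)
import Data.List.Properties as List
open import Data.Product using (_,_; proj₂)
open import Function using (id; _∘_)
open import Relation.Nullary using (does)
open import Relation.Binary.PropositionalEquality
open import Algebra.Properties.Semiring.Sum +-*-semiring
  using (sum-syntax; sum-cong-≗; sum-replicate-zero; ∑-distrib-+; *-distribˡ-sum; *-distribʳ-sum)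
open ≡-Reasoning

⟦_⟧ : Bool → ℕ
⟦ b ⟧ = if b then 1 else 0

⟦∧⟧ : ∀ a b → ⟦ a ∧ b ⟧ ≡ ⟦ a ⟧ * ⟦ b ⟧
⟦∧⟧ true  b = sym (+-identityʳ ⟦ b ⟧)
⟦∧⟧ false b = refl

⟦⟧+⟦not⟧ : ∀ c → ⟦ c ⟧ + ⟦ not c ⟧ ≡ 1
⟦⟧+⟦not⟧ true  = refl
⟦⟧+⟦not⟧ false = refl

if-as-⟦⟧ : ∀ b m → (if b then m else 0) ≡ ⟦ b ⟧ * m
if-as-⟦⟧ true  m = sym (+-identityʳ m)
if-as-⟦⟧ false m = refl

-- Contribution of one coordinate to the Hamming distance (cf. dist).
δ : Bool → ℕ
δ c = if c then 0 else 1

dist-zero-split : ∀ c D → ⟦ δ c + D ≡ᵇ 0 ⟧ ≡ ⟦ c ⟧ * ⟦ D ≡ᵇ 0 ⟧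
dist-zero-split true  D = sym (+-identityʳ _)
dist-zero-split false D = refl

dist-one-split : ∀ c D → ⟦ δ c + D ≡ᵇ 1 ⟧ ≡ ⟦ c ⟧ * ⟦ D ≡ᵇ 1 ⟧ + ⟦ not c ⟧ * ⟦ D ≡ᵇ 0 ⟧
dist-one-split true  D = sym (trans (+-identityʳ _) (+-identityʳ _))
dist-one-split false D = sym (+-identityʳ _)

dist≡0-is-== : ∀ {n k} (u v : Vtx n k) → (dist u v ≡ᵇ 0) ≡ (u == v)
dist≡0-is-== []       []       = refl
dist≡0-is-== (x ∷ xs) (y ∷ ys) with does (x Fin.≟ y)
... | true  = dist≡0-is-== xs ys
... | false = refl

∑-pick : ∀ {k} (x : Fin k) (g : Fin k → ℕ) →
  ∑[ i < k ] (g i * ⟦ does (x Fin.≟ i) ⟧) ≡ g x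
∑-pick {suc k} Fin.zero g = begin
    g Fin.zero * 1 + ∑[ i < k ] (g (Fin.suc i) * 0)
  ≡⟨ cong (g Fin.zero * 1 +_) (trans (sum-cong-≗ (*-zeroʳ ∘ g ∘ Fin.suc)) (sum-replicate-zero k)) ⟩
    g Fin.zero * 1 + 0
  ≡⟨ trans (+-identityʳ _) (*-identityʳ _) ⟩
    g Fin.zero
  ∎
∑-pick {suc k} (Fin.suc x) g =
  trans (cong (_+ ∑[ i < k ] (g (Fin.suc i) * ⟦ does (x Fin.≟ i) ⟧)) (*-zeroʳ (g Fin.zero)))
        (∑-pick x (g ∘ Fin.suc))

∑-pick+rest : ∀ {k} (x : Fin k) (g : Fin k → ℕ) →
  g x + ∑[ i < k ] (g i * ⟦ not (does (x Fin.≟ i)) ⟧) ≡ ∑[ i < k ] g i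
∑-pick+rest {k} x g = begin
    g x + ∑[ i < k ] off i
  ≡⟨ cong (_+ ∑[ i < k ] off i) (sym (∑-pick x g)) ⟩
    ∑[ i < k ] on i + ∑[ i < k ] off i
  ≡⟨ sym (∑-distrib-+ on off) ⟩
    ∑[ i < k ] (on i + off i)
  ≡⟨ sum-cong-≗ on+off≡g ⟩
    ∑[ i < k ] g i
  ∎
  where
  c : Fin k → Bool
  c i = does (x Fin.≟ i)
  on off : Fin k → ℕ
  on  i = g i * ⟦ c i ⟧
  off i = g i * ⟦ not (c i) ⟧
  on+off≡g : ∀ i → on i + off i ≡ g i
  on+off≡g i = begin
      g i * ⟦ c i ⟧ + g i * ⟦ not (c i) ⟧  ≡⟨ sym (*-distribˡ-+ (g i) ⟦ c i ⟧ ⟦ not (c i) ⟧) ⟩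
      g i * (⟦ c i ⟧ + ⟦ not (c i) ⟧)      ≡⟨ cong (g i *_) (⟦⟧+⟦not⟧ (c i)) ⟩
      g i * 1                              ≡⟨ *-identityʳ (g i) ⟩
      g i                                  ∎

∑-indicator : ∀ {k} (y : Fin k) → ∑[ i < k ] ⟦ does (i Fin.≟ y) ⟧ ≡ 1
∑-indicator {suc k} Fin.zero    = cong suc (sum-replicate-zero k)
∑-indicator {suc k} (Fin.suc y) = ∑-indicator y

∑-ones : ∀ m → ∑[ a < m ] 1 ≡ m
∑-ones zero    = refl
∑-ones (suc m) = cong suc (∑-ones m)

∑-++ : ∀ m {n} (g : Fin (m + n) → ℕ) →
  ∑[ i < m + n ] g i ≡ ∑[ i < m ] g (i ↑ˡ n) + ∑[ j < n ] g (m ↑ʳ j)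
∑-++ zero    g = refl
∑-++ (suc m) g = trans (cong (g Fin.zero +_) (∑-++ m (g ∘ Fin.suc))) (sym (+-assoc (g Fin.zero) _ _))

∑-combine : ∀ m {n} (g : Fin (m * n) → ℕ) →
  ∑[ i < m * n ] g i ≡ ∑[ a < m ] ∑[ b < n ] g (combine a b)
∑-combine zero        g = refl
∑-combine (suc m) {n} g =
  trans (∑-++ n g) (cong (∑[ b < n ] g (b ↑ˡ (m * n)) +_) (∑-combine m (g ∘ (n ↑ʳ_))))

sum-tabulate : ∀ {k} (g : Fin k → ℕ) → sum (tabulate g) ≡ ∑[ i < k ] g i
sum-tabulate {zero}  g = refl
sum-tabulate {suc k} g = cong (g Fin.zero +_) (sum-tabulate (g ∘ Fin.suc))

∑V-row : ∀ {k} n → (Vtx (suc n) k → ℕ) → Fin k → ℕ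
∑V-row n f i = ∑V n (λ us → f (i ∷ us))

∑V-step : ∀ {k} n (f : Vtx (suc n) k → ℕ) → ∑V (suc n) f ≡ ∑[ i < k ] ∑V-row n f i
∑V-step n f = trans (cong sum (map-tabulate id (∑V-row n f))) (sum-tabulate (∑V-row n f))

∑V-cong : ∀ {k} n {f g : Vtx n k → ℕ} → (∀ u → f u ≡ g u) → ∑V n f ≡ ∑V n g
∑V-cong zero        f≗g = f≗g []
∑V-cong {k} (suc n) f≗g =
  cong sum (List.map-cong (λ i → ∑V-cong n (f≗g ∘ (i ∷_))) (allFin k))

∑V-+ : ∀ {k} n (f g : Vtx n k → ℕ) → ∑V n (λ u → f u + g u) ≡ ∑V n f + ∑V n g
∑V-+ zero        f g = refl
∑V-+ {k} (suc n) f g = begin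
    ∑V (suc n) (λ u → f u + g u)
  ≡⟨ ∑V-step n (λ u → f u + g u) ⟩
    ∑[ i < k ] ∑V-row n (λ u → f u + g u) i
  ≡⟨ sum-cong-≗ (λ i → ∑V-+ n (λ us → f (i ∷ us)) (λ us → g (i ∷ us))) ⟩
    ∑[ i < k ] (∑V-row n f i + ∑V-row n g i)
  ≡⟨ ∑-distrib-+ (∑V-row n f) (∑V-row n g) ⟩
    ∑[ i < k ] ∑V-row n f i + ∑[ i < k ] ∑V-row n g i
  ≡⟨ sym (cong₂ _+_ (∑V-step n f) (∑V-step n g)) ⟩
    ∑V (suc n) f + ∑V (suc n) g
  ∎

∑V-*ˡ : ∀ {k} n (c : ℕ) (f : Vtx n k → ℕ) → ∑V n (λ u → c * f u) ≡ c * ∑V n f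
∑V-*ˡ zero        c f = refl
∑V-*ˡ {k} (suc n) c f = begin
    ∑V (suc n) (λ u → c * f u)
  ≡⟨ ∑V-step n (λ u → c * f u) ⟩
    ∑[ i < k ] ∑V-row n (λ u → c * f u) i
  ≡⟨ sum-cong-≗ (λ i → ∑V-*ˡ n c (λ us → f (i ∷ us))) ⟩
    ∑[ i < k ] (c * ∑V-row n f i)
  ≡⟨ sym (*-distribˡ-sum c (∑V-row n f)) ⟩
    c * ∑[ i < k ] ∑V-row n f i
  ≡⟨ cong (c *_) (sym (∑V-step n f)) ⟩
    c * ∑V (suc n) f
  ∎

∑V-product : ∀ {k} n (α : Fin k → ℕ) (g : Vtx n k → ℕ) →
  ∑V (suc n) (λ u → α (Vec.head u) * g (Vec.tail u)) ≡ (∑[ i < k ] α i) * ∑V n g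
∑V-product {k} n α g = begin
    ∑V (suc n) (λ u → α (Vec.head u) * g (Vec.tail u))
  ≡⟨ ∑V-step n (λ u → α (Vec.head u) * g (Vec.tail u)) ⟩
    ∑[ i < k ] ∑V n (λ us → α i * g us)
  ≡⟨ sum-cong-≗ (λ i → ∑V-*ˡ n (α i) g) ⟩
    ∑[ i < k ] (α i * ∑V n g)
  ≡⟨ sym (*-distribʳ-sum (∑V n g) α) ⟩
    (∑[ i < k ] α i) * ∑V n g
  ∎

-- The summands counting preimages at distance 0 resp. 1 factor over the
-- first coordinate (a, c: first coordinates; b, D: the remaining ones).
zero-summand : ∀ a b c D →
  ⟦ a ∧ b ⟧ * ⟦ δ c + D ≡ᵇ 0 ⟧ ≡ (⟦ a ⟧ * ⟦ c ⟧) * (⟦ b ⟧ * ⟦ D ≡ᵇ 0 ⟧)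
zero-summand a b c D = begin
    ⟦ a ∧ b ⟧ * ⟦ δ c + D ≡ᵇ 0 ⟧
  ≡⟨ cong₂ _*_ (⟦∧⟧ a b) (dist-zero-split c D) ⟩
    (⟦ a ⟧ * ⟦ b ⟧) * (⟦ c ⟧ * ⟦ D ≡ᵇ 0 ⟧)
  ≡⟨ interchange ⟦ a ⟧ ⟦ b ⟧ ⟦ c ⟧ ⟦ D ≡ᵇ 0 ⟧ ⟩
    (⟦ a ⟧ * ⟦ c ⟧) * (⟦ b ⟧ * ⟦ D ≡ᵇ 0 ⟧)
  ∎
  where
  interchange : ∀ x y z t → (x * y) * (z * t) ≡ (x * z) * (y * t)
  interchange = solve-∀

one-summand : ∀ a b c D →
  ⟦ a ∧ b ⟧ * ⟦ δ c + D ≡ᵇ 1 ⟧ ≡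
    (⟦ a ⟧ * ⟦ c ⟧) * (⟦ b ⟧ * ⟦ D ≡ᵇ 1 ⟧) + (⟦ a ⟧ * ⟦ not c ⟧) * (⟦ b ⟧ * ⟦ D ≡ᵇ 0 ⟧)
one-summand a b c D = begin
    ⟦ a ∧ b ⟧ * ⟦ δ c + D ≡ᵇ 1 ⟧
  ≡⟨ cong₂ _*_ (⟦∧⟧ a b) (dist-one-split c D) ⟩
    (⟦ a ⟧ * ⟦ b ⟧) * (⟦ c ⟧ * ⟦ D ≡ᵇ 1 ⟧ + ⟦ not c ⟧ * ⟦ D ≡ᵇ 0 ⟧)
  ≡⟨ distribute ⟦ a ⟧ ⟦ b ⟧ ⟦ c ⟧ ⟦ not c ⟧ ⟦ D ≡ᵇ 1 ⟧ ⟦ D ≡ᵇ 0 ⟧ ⟩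
    (⟦ a ⟧ * ⟦ c ⟧) * (⟦ b ⟧ * ⟦ D ≡ᵇ 1 ⟧) + (⟦ a ⟧ * ⟦ not c ⟧) * (⟦ b ⟧ * ⟦ D ≡ᵇ 0 ⟧)
  ∎
  where
  distribute : ∀ x y z z′ t t′ →
    (x * y) * (z * t + z′ * t′) ≡ (x * z) * (y * t) + (x * z′) * (y * t′)
  distribute = solve-∀

-- The arithmetic of the induction step for distance 1: a says whether the
-- first coordinate maps correctly, R counts the other first coordinates
-- mapping correctly, E and B are the brackets [d = 1] and [φ = w] behind.
distance-one-step : ∀ n p a R E B → ⟦ a ⟧ + R ≡ p →
  ⟦ a ⟧ * (p * E + B * (n * (p ∸ 1))) + R * B
    ≡ p * (⟦ a ⟧ * E + ⟦ not a ⟧ * B) + (⟦ a ⟧ * B) * (suc n * (p ∸ 1))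
distance-one-step n .(suc R) true  R E B refl = identity n R E B
  where
  identity : ∀ n R E B → 1 * (suc R * E + B * (n * R)) + R * B
    ≡ suc R * (1 * E + 0 * B) + (1 * B) * (suc n * R)
  identity = solve-∀
distance-one-step n .R       false R E B refl = identity n R E B
  where
  identity : ∀ n R E B → 0 * (R * E + B * (n * (R ∸ 1))) + R * B
    ≡ R * (0 * E + 1 * B) + (0 * B) * (suc n * (R ∸ 1))
  identity n R E B = sym (trans (+-identityʳ _) (cong (R *_) (+-identityʳ B)))

module EquitableCover {k l : ℕ} (f : Fin k → Fin l) (p : ℕ)
  (fibre : ∀ y → ∑[ i < k ] ⟦ does (f i Fin.≟ y) ⟧ ≡ p) where

  φ : ∀ {n} → Vtx n k → Vtx n l
  φ = Vec.map f

  preimage-at : ∀ {n} → ℕ → Vtx n k → Vtx n l → Vtx n k → ℕ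
  preimage-at d v w u = ⟦ φ u == w ⟧ * ⟦ dist v u ≡ᵇ d ⟧

  preimages : ∀ n → ℕ → Vtx n k → Vtx n l → ℕ
  preimages n d v w = ∑V n (preimage-at d v w)

  same other : Fin k → Fin l → Fin k → ℕ
  same  x y i = ⟦ does (f i Fin.≟ y) ⟧ * ⟦ does (x Fin.≟ i) ⟧
  other x y i = ⟦ does (f i Fin.≟ y) ⟧ * ⟦ not (does (x Fin.≟ i)) ⟧

  ∑-same : ∀ x y → ∑[ i < k ] same x y i ≡ ⟦ does (f x Fin.≟ y) ⟧
  ∑-same x y = ∑-pick x (λ i → ⟦ does (f i Fin.≟ y) ⟧)

  ∑-other : ∀ x y → ⟦ does (f x Fin.≟ y) ⟧ + ∑[ i < k ] other x y i ≡ p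
  ∑-other x y = trans (∑-pick+rest x (λ i → ⟦ does (f i Fin.≟ y) ⟧)) (fibre y)

  preimage-at-0-factors : ∀ {n} x (vs : Vtx n k) y ws (u : Vtx (suc n) k) →
    preimage-at 0 (x ∷ vs) (y ∷ ws) u
      ≡ same x y (Vec.head u) * preimage-at 0 vs ws (Vec.tail u)
  preimage-at-0-factors x vs y ws (i ∷ us) =
    zero-summand (does (f i Fin.≟ y)) (φ us == ws) (does (x Fin.≟ i)) (dist vs us)

  preimage-at-1-factors : ∀ {n} x (vs : Vtx n k) y ws (u : Vtx (suc n) k) →
    preimage-at 1 (x ∷ vs) (y ∷ ws) u
      ≡ same x y (Vec.head u) * preimage-at 1 vs ws (Vec.tail u)
        + other x y (Vec.head u) * preimage-at 0 vs ws (Vec.tail u)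
  preimage-at-1-factors x vs y ws (i ∷ us) =
    one-summand (does (f i Fin.≟ y)) (φ us == ws) (does (x Fin.≟ i)) (dist vs us)

  preimages-0 : ∀ n v w → preimages n 0 v w ≡ ⟦ φ v == w ⟧
  preimages-0 zero    []       []       = refl
  preimages-0 (suc n) (x ∷ vs) (y ∷ ws) = begin
      preimages (suc n) 0 (x ∷ vs) (y ∷ ws)
    ≡⟨ ∑V-cong (suc n) (preimage-at-0-factors x vs y ws) ⟩
      ∑V (suc n) (λ u → same x y (Vec.head u) * preimage-at 0 vs ws (Vec.tail u))
    ≡⟨ ∑V-product n (same x y) (preimage-at 0 vs ws) ⟩
      (∑[ i < k ] same x y i) * preimages n 0 vs ws
    ≡⟨ cong₂ _*_ (∑-same x y) (preimages-0 n vs ws) ⟩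
      ⟦ does (f x Fin.≟ y) ⟧ * ⟦ φ vs == ws ⟧
    ≡⟨ sym (⟦∧⟧ (does (f x Fin.≟ y)) (φ vs == ws)) ⟩
      ⟦ φ (x ∷ vs) == (y ∷ ws) ⟧
    ∎

  preimages-1 : ∀ n v w →
    preimages n 1 v w ≡ p * ⟦ dist (φ v) w ≡ᵇ 1 ⟧ + ⟦ φ v == w ⟧ * (n * (p ∸ 1))
  preimages-1 zero    []       []       = sym (trans (+-identityʳ (p * 0)) (*-zeroʳ p))
  preimages-1 (suc n) (x ∷ vs) (y ∷ ws) = begin
      preimages (suc n) 1 (x ∷ vs) (y ∷ ws)
    ≡⟨ ∑V-cong (suc n) (preimage-at-1-factors x vs y ws) ⟩
      ∑V (suc n) (λ u → keep-first u + change-first u)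
    ≡⟨ ∑V-+ (suc n) keep-first change-first ⟩
      ∑V (suc n) keep-first + ∑V (suc n) change-first
    ≡⟨ cong₂ _+_ (∑V-product n (same x y) (preimage-at 1 vs ws))
                 (∑V-product n (other x y) (preimage-at 0 vs ws)) ⟩
      (∑[ i < k ] same x y i) * preimages n 1 vs ws
        + (∑[ i < k ] other x y i) * preimages n 0 vs ws
    ≡⟨ cong₂ _+_ (cong₂ _*_ (∑-same x y) (preimages-1 n vs ws))
                 (cong (R *_) (preimages-0 n vs ws)) ⟩
      ⟦ a ⟧ * (p * ⟦ D ≡ᵇ 1 ⟧ + ⟦ b ⟧ * (n * (p ∸ 1))) + R * ⟦ b ⟧
    ≡⟨ distance-one-step n p a R ⟦ D ≡ᵇ 1 ⟧ ⟦ b ⟧ (∑-other x y) ⟩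
      p * (⟦ a ⟧ * ⟦ D ≡ᵇ 1 ⟧ + ⟦ not a ⟧ * ⟦ b ⟧) + (⟦ a ⟧ * ⟦ b ⟧) * (suc n * (p ∸ 1))
    ≡⟨ sym (cong₂ _+_ (cong (p *_) dist-one) (cong (_* (suc n * (p ∸ 1))) (⟦∧⟧ a b))) ⟩
      p * ⟦ dist (φ (x ∷ vs)) (y ∷ ws) ≡ᵇ 1 ⟧ + ⟦ φ (x ∷ vs) == (y ∷ ws) ⟧ * (suc n * (p ∸ 1))
    ∎
    where
    keep-first change-first : Vtx (suc n) k → ℕ
    keep-first   u = same x y (Vec.head u) * preimage-at 1 vs ws (Vec.tail u)
    change-first u = other x y (Vec.head u) * preimage-at 0 vs ws (Vec.tail u)
    a b : Bool
    a = does (f x Fin.≟ y)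
    b = φ vs == ws
    D : ℕ
    D = dist (φ vs) ws
    R : ℕ
    R = ∑[ i < k ] other x y i
    dist-one : ⟦ δ a + D ≡ᵇ 1 ⟧ ≡ ⟦ a ⟧ * ⟦ D ≡ᵇ 1 ⟧ + ⟦ not a ⟧ * ⟦ b ⟧
    dist-one = trans (dist-one-split a D)
                     (cong (λ e → ⟦ a ⟧ * ⟦ D ≡ᵇ 1 ⟧ + ⟦ not a ⟧ * ⟦ e ⟧) (dist≡0-is-== (φ vs) ws))

  covers : ∀ n (s : Fin l → Fin k) → (∀ y → f (s y) ≡ y) →
    Covers (Hamming n k) (addLoops (scale p (Hamming n l)) (n * (p ∸ 1)))
  covers n s fs = φ , surjective , λ v w → begin
      ∑V n (λ u → if φ u == w then Hamming n k v u else 0)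
    ≡⟨ ∑V-cong n (λ u → if-as-⟦⟧ (φ u == w) (Hamming n k v u)) ⟩
      preimages n 1 v w
    ≡⟨ preimages-1 n v w ⟩
      p * Hamming n l (φ v) w + ⟦ φ v == w ⟧ * (n * (p ∸ 1))
    ≡⟨ cong (p * Hamming n l (φ v) w +_) (sym (if-as-⟦⟧ (φ v == w) (n * (p ∸ 1)))) ⟩
      addLoops (scale p (Hamming n l)) (n * (p ∸ 1)) (φ v) w
    ∎
    where
    surjective : Surj (φ {n})
    surjective w = Vec.map s w , (begin
        Vec.map f (Vec.map s w)  ≡⟨ sym (Vec.map-∘ f s w) ⟩
        Vec.map (f ∘ s) w        ≡⟨ Vec.map-cong fs w ⟩
        Vec.map id w             ≡⟨ Vec.map-id w ⟩
        w                        ∎)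

remainder-combine : ∀ {p q} (a : Fin p) (b : Fin q) → remainder {p} q (combine a b) ≡ b
remainder-combine a b = cong proj₂ (remQuot-combine a b)

remainder-fibre : ∀ p q (y : Fin q) → ∑[ i < p * q ] ⟦ does (remainder {p} q i Fin.≟ y) ⟧ ≡ p
remainder-fibre p q y = begin
    ∑[ i < p * q ] ⟦ does (remainder {p} q i Fin.≟ y) ⟧
  ≡⟨ ∑-combine p (λ i → ⟦ does (remainder {p} q i Fin.≟ y) ⟧) ⟩
    ∑[ a < p ] ∑[ b < q ] ⟦ does (remainder {p} q (combine a b) Fin.≟ y) ⟧
  ≡⟨ sum-cong-≗ {p} (λ a → sum-cong-≗ {q} (λ b → cong (λ z → ⟦ does (z Fin.≟ y) ⟧) (remainder-combine a b))) ⟩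
    ∑[ a < p ] ∑[ b < q ] ⟦ does (b Fin.≟ y) ⟧
  ≡⟨ sum-cong-≗ {p} (λ _ → ∑-indicator y) ⟩
    ∑[ a < p ] 1
  ≡⟨ ∑-ones p ⟩
    p
  ∎

-- Reduction modulo q covers.
proposition7 : (n p q : ℕ) → 1 ≤ n → 1 ≤ p → 2 ≤ q →
    Covers (Hamming n (p * q)) (addLoops (scale p (Hamming n q)) (n * (p ∸ 1)))
proposition7 n (suc p) q _ _ _ =
  EquitableCover.covers (remainder {suc p} q) (suc p) (remainder-fibre (suc p) q)
    n (combine {suc p} Fin.zero) (remainder-combine {suc p} Fin.zero)
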